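{- There is an infinite family $(\mathcal{I}_n)_{n\ge 1}$ of sets of intervals such that, for every $n\ge1$, $|\mathcal{I}_n| = 3\cdot 2^{n-1}-2$, $\chi(\mathcal{C}[\mathcal{I}_n]) = 2n-1$, and $\omega(\mathcal{C}[\mathcal{I}_n]) = n$.
   Context: For a finite set $\mathcal{I}$ of intervals on the real line, the containment interval graph $\mathcal{C}[\mathcal{I}]$ is the mixed graph with vertex set $\mathcal{I}$ in which, for every pair of distinct intersecting intervals $u,v$: there is an arc $(u,v)$ if $u$ contains $v$, and an (undirected) edge $\{u,v\}$ if $u$ and $v$ overlap (intersect but neither contains the other). A proper coloring of a mixed graph $G$ is a function $f\colon V(G)\to\mathbb{N}$ such that $f(u)\neq f(v)$ for every edge $\{u,v\}$ and $f(u)<f(v)$ for every arc $(u,v)$. $\chi(G)$ is the minimum number of colors in a proper coloring of $G$, and $\omega(G)$ is the size of a largest clique in the underlying undirected graph of $G$ (which has an edge for every edge or arc of $G$). -}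

module Defs where

open import Data.Nat using (ℕ; _≤_; _<_)
open import Data.Fin using (Fin; toℕ)
open import Data.Product using (_×_; Σ; ∃; _,_)
open import Data.Sum using (_⊎_)
open import Relation.Nullary using (¬_)
open import Relation.Binary.PropositionalEquality using (_≡_; _≢_)
open import Function.Definitions using (Injective)

-- Endpoints are natural numbers (any finite interval
-- configuration is combinatorially realizable with integer endpoints,
-- and the claim is an existence statement).
record Interval : Set where
  constructor [_,_]⟨_⟩
  field
    lo : ℕ
    hi : ℕ
    lo≤hi : lo ≤ hi
open Interval public

SameInterval : Interval → Interval → Set
SameInterval u v = (lo u ≡ lo v) × (hi u ≡ hi v)

record IntervalSet : Set where
  field
    size      : ℕ
    interval  : Fin size → Interval
    distinct  : ∀ i j → SameInterval (interval i) (interval j) → i ≡ j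
open IntervalSet public

Intersect : Interval → Interval → Set
Intersect u v = (lo u ≤ hi v) × (lo v ≤ hi u)

Contains : Interval → Interval → Set
Contains u v = (lo u ≤ lo v) × (hi v ≤ hi u)

Overlap : Interval → Interval → Set
Overlap u v = Intersect u v × ¬ Contains u v × ¬ Contains v u

module _ (I : IntervalSet) where
  private
    V = Fin (size I)
    J = interval I

  Arc : V → V → Set
  Arc u v = u ≢ v × Intersect (J u) (J v) × Contains (J u) (J v)

  Edge : V → V → Set
  Edge u v = u ≢ v × Overlap (J u) (J v)

  Adjacent : V → V → Set
  Adjacent u v = Edge u v ⊎ Arc u v ⊎ Arc v u

  ProperColoring : (V → ℕ) → Set
  ProperColoring f = (∀ u v → Edge u v → f u ≢ f v)
                   × (∀ u v → Arc u v → f u < f v)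

  Colorable : ℕ → Set
  Colorable k = Σ (V → Fin k) λ f → ProperColoring (λ v → toℕ (f v))

  ChromaticNumber : ℕ → Set
  ChromaticNumber k = Colorable k × (∀ j → Colorable j → k ≤ j)

  HasClique : ℕ → Set
  HasClique k = Σ (Fin k → V) λ c → Injective _≡_ _≡_ c
                  × (∀ a b → a ≢ b → Adjacent (c a) (c b))

  CliqueNumber : ℕ → Set
  CliqueNumber k = HasClique k × (∀ j → HasClique j → j ≤ k)

-- The family is built recursively, ℐ m playing the role of 𝓘ₙ for n = m + 1.  ℐ 0 is a
-- single point; ℐ (m + 1) consists of two intervals L and R overlapping in one point,
-- each strictly containing a copy of ℐ m, the two copies being disjoint from each other
-- and from the other big interval.  So the size doubles plus 2.
-- Colouring: given a proper colouring f with all colours ≥ c, either f L > c and the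
-- copy inside L is coloured from c + 2 on, or f L = c, then f R > c since L and R
-- overlap, and the copy inside R is coloured from c + 2 on.  By induction some interval
-- gets colour ≥ 2m; colouring L, R and the two copies by 1, 0, 2 + colour, 1 + colour
-- shows that 2m + 1 colours suffice.  Cliques: L together with a clique of its copy is
-- a clique of size m + 1, and a proper colouring of the intersection graph by m + 1
-- layers bounds every clique.
module Submission where

open import Defs
open import Data.Nat using (ℕ; zero; suc; pred; _+_; _*_; _∸_; _^_; _≤_; _<_; z≤n; s≤s; _≤?_)
open import Data.Nat.Properties
open import Data.Nat.Solver using (module +-*-Solver)
open import Data.Fin as Fin using (Fin; toℕ; fromℕ; fromℕ<; inject₁; splitAt; _↑ˡ_; _↑ʳ_)
open import Data.Fin.Properties
  using (splitAt-↑ˡ; splitAt-↑ʳ; splitAt⁻¹-↑ˡ; splitAt⁻¹-↑ʳ; toℕ-fromℕ<; toℕ<n;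
         injective⇒≤; fromℕ≢inject₁; inject₁-injective)
  renaming (suc-injective to Fin-suc-injective)
open import Data.Vec.Functional using (_∷_)
open import Data.Product using (Σ; ∃-syntax; _×_; _,_; proj₁; proj₂)
open import Data.Sum using (inj₁; inj₂; [_,_]′)
open import Relation.Nullary using (¬_; yes; no; contradiction)
open import Relation.Binary.PropositionalEquality
open import Function using (_∘_)
open import Function.Definitions using (Injective)

-- Geometry of intervals

shift : ℕ → Interval → Interval
shift k u = [ k + lo u , k + hi u ]⟨ +-monoʳ-≤ k (lo≤hi u) ⟩

record Within (a b : ℕ) (u : Interval) : Set where
  constructor within
  field
    lower : a ≤ lo u
    upper : hi u ≤ b

Within-weaken : ∀ {a a′ b b′ u} → a′ ≤ a → b ≤ b′ → Within a b u → Within a′ b′ u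
Within-weaken a′≤a b≤b′ (within a≤lo hi≤b) = within (≤-trans a′≤a a≤lo) (≤-trans hi≤b b≤b′)

Within-shift : ∀ k {a b u} → Within a b u → Within (k + a) (k + b) (shift k u)
Within-shift k (within a≤lo hi≤b) = within (+-monoʳ-≤ k a≤lo) (+-monoʳ-≤ k hi≤b)

Within⇒Contains : ∀ {u v} → Within (lo u) (hi u) v → Contains u v
Within⇒Contains (within lo≤lo hi≤hi) = lo≤lo , hi≤hi

separated : ∀ {a b c d u v} → Within a b u → Within c d v → b < c → ¬ Intersect u v
separated (within _ hi≤b) (within c≤lo _) b<c (_ , lo≤hi) =
  <⇒≱ b<c (≤-trans c≤lo (≤-trans lo≤hi hi≤b))

lo<lo⇒¬Contains : ∀ {u v} → lo v < lo u → ¬ Contains u v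
lo<lo⇒¬Contains lo<lo (lo≤lo , _) = <⇒≱ lo<lo lo≤lo

Contains⇒Intersect : ∀ {u v} → Contains u v → Intersect u v
Contains⇒Intersect {u} {v} (lo≤lo , hi≤hi) =
  ≤-trans lo≤lo (lo≤hi v) , ≤-trans (lo≤hi v) hi≤hi

Intersect-sym : ∀ {u v} → Intersect u v → Intersect v u
Intersect-sym (p , q) = q , p

Overlap-sym : ∀ {u v} → Overlap u v → Overlap v u
Overlap-sym {u} {v} (i , u⊉v , v⊉u) = Intersect-sym {u} {v} i , v⊉u , u⊉v

SameInterval⇒Contains : ∀ {u v} → SameInterval u v → Contains u v
SameInterval⇒Contains (lo≡ , hi≡) = ≤-reflexive lo≡ , ≤-reflexive (sym hi≡)

SameInterval-sym : ∀ {u v} → SameInterval u v → SameInterval v u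
SameInterval-sym (lo≡ , hi≡) = sym lo≡ , sym hi≡

SameInterval⇒Intersect : ∀ {u v} → SameInterval u v → Intersect u v
SameInterval⇒Intersect {u} {v} (lo≡ , hi≡) =
  subst (lo u ≤_) hi≡ (lo≤hi u) , subst (_≤ hi u) lo≡ (lo≤hi u)

shift-Intersect : ∀ k {u v} → Intersect u v → Intersect (shift k u) (shift k v)
shift-Intersect k (p , q) = +-monoʳ-≤ k p , +-monoʳ-≤ k q

shift-Intersect⁻¹ : ∀ k {u v} → Intersect (shift k u) (shift k v) → Intersect u v
shift-Intersect⁻¹ k (p , q) = +-cancelˡ-≤ k _ _ p , +-cancelˡ-≤ k _ _ q

shift-Contains : ∀ k {u v} → Contains u v → Contains (shift k u) (shift k v)
shift-Contains k (p , q) = +-monoʳ-≤ k p , +-monoʳ-≤ k q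

shift-Contains⁻¹ : ∀ k {u v} → Contains (shift k u) (shift k v) → Contains u v
shift-Contains⁻¹ k (p , q) = +-cancelˡ-≤ k _ _ p , +-cancelˡ-≤ k _ _ q

shift-Overlap : ∀ k {u v} → Overlap u v → Overlap (shift k u) (shift k v)
shift-Overlap k {u} {v} (i , u⊉v , v⊉u) =
  shift-Intersect k {u} {v} i , u⊉v ∘ shift-Contains⁻¹ k {u} {v} , v⊉u ∘ shift-Contains⁻¹ k {v} {u}

shift-Overlap⁻¹ : ∀ k {u v} → Overlap (shift k u) (shift k v) → Overlap u v
shift-Overlap⁻¹ k {u} {v} (i , u⊉v , v⊉u) =
  shift-Intersect⁻¹ k {u} {v} i , u⊉v ∘ shift-Contains k {u} {v} , v⊉u ∘ shift-Contains k {v} {u}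

-- Colourings and cliques of containment interval graphs

module _ (I : IntervalSet) where
  private
    V = Fin (size I)

  Adjacent-sym : ∀ {u v} → Adjacent I u v → Adjacent I v u
  Adjacent-sym {u} {v} (inj₁ (u≢v , o)) = inj₁ (u≢v ∘ sym , Overlap-sym {interval I u} {interval I v} o)
  Adjacent-sym (inj₂ (inj₁ arc)) = inj₂ (inj₂ arc)
  Adjacent-sym (inj₂ (inj₂ arc)) = inj₂ (inj₁ arc)

  Adjacent⇒≢ : ∀ {u v} → Adjacent I u v → u ≢ v
  Adjacent⇒≢ (inj₁ (u≢v , _))         = u≢v
  Adjacent⇒≢ (inj₂ (inj₁ (u≢v , _)))  = u≢v
  Adjacent⇒≢ (inj₂ (inj₂ (v≢u , _)))  = v≢u ∘ sym

  Adjacent⇒Intersect : ∀ {u v} → Adjacent I u v → Intersect (interval I u) (interval I v)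
  Adjacent⇒Intersect (inj₁ (_ , i , _))         = i
  Adjacent⇒Intersect (inj₂ (inj₁ (_ , i , _)))  = i
  Adjacent⇒Intersect {u} {v} (inj₂ (inj₂ (_ , i , _))) = Intersect-sym {interval I v} {interval I u} i

  IsClique : ∀ {k} → (Fin k → V) → Set
  IsClique c = ∀ a b → a ≢ b → Adjacent I (c a) (c b)

  IsClique⇒HasClique : ∀ {k} (c : Fin k → V) → IsClique c → HasClique I k
  IsClique⇒HasClique c clique = c , c-injective , clique
    where
    c-injective : Injective _≡_ _≡_ c
    c-injective {a} {b} ca≡cb with a Fin.≟ b
    ... | yes a≡b = a≡b
    ... | no  a≢b = contradiction ca≡cb (Adjacent⇒≢ (clique a b a≢b))

  IsClique-cons : ∀ {k} (w : V) (c : Fin k → V) → (∀ a → Adjacent I w (c a)) → IsClique c →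
                  IsClique (w ∷ c)
  IsClique-cons w c w∼c clique Fin.zero    Fin.zero    0≢0 = contradiction refl 0≢0
  IsClique-cons w c w∼c clique Fin.zero    (Fin.suc b) _   = w∼c b
  IsClique-cons w c w∼c clique (Fin.suc a) Fin.zero    _   = Adjacent-sym (w∼c a)
  IsClique-cons w c w∼c clique (Fin.suc a) (Fin.suc b) a≢b = clique a b (a≢b ∘ cong Fin.suc)

  HasClique⇒≤ : ∀ {k j} (g : V → Fin k) → (∀ {u v} → Adjacent I u v → g u ≢ g v) →
                HasClique I j → j ≤ k
  HasClique⇒≤ g separates (c , _ , clique) = injective⇒≤ g∘c-injective
    where
    g∘c-injective : Injective _≡_ _≡_ (g ∘ c)
    g∘c-injective {a} {b} gca≡gcb with a Fin.≟ b
    ... | yes a≡b = a≡b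
    ... | no  a≢b = contradiction gca≡gcb (separates (clique a b a≢b))

  ChromaticNumber-intro : ∀ d (f : V → ℕ) → ProperColoring I f → (∀ v → f v ≤ d) →
                          (∀ g → ProperColoring I g → ∃[ v ] d ≤ g v) →
                          ChromaticNumber I (suc d)
  ChromaticNumber-intro d f (edge≢ , arc<) f≤d spread = (colouring , proper) , minimal
    where
    colouring : V → Fin (suc d)
    colouring v = fromℕ< (s≤s (f≤d v))

    toℕ-colouring : ∀ v → toℕ (colouring v) ≡ f v
    toℕ-colouring v = toℕ-fromℕ< (s≤s (f≤d v))

    proper : ProperColoring I (toℕ ∘ colouring)
    proper = (λ u v e → edge≢ u v e ∘ subst₂ _≡_ (toℕ-colouring u) (toℕ-colouring v))
           , (λ u v a → subst₂ _<_ (sym (toℕ-colouring u)) (sym (toℕ-colouring v)) (arc< u v a))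

    minimal : ∀ j → Colorable I j → suc d ≤ j
    minimal j (g , g-proper) with spread (toℕ ∘ g) g-proper
    ... | v , d≤gv = ≤-trans (s≤s d≤gv) (toℕ<n (g v))

record IsHomomorphism (I J : IntervalSet) (φ : Fin (size I) → Fin (size J)) : Set where
  field
    preserves-Edge : ∀ u v → Edge I u v → Edge J (φ u) (φ v)
    preserves-Arc  : ∀ u v → Arc I u v → Arc J (φ u) (φ v)

module _ {I J : IntervalSet} {φ : Fin (size I) → Fin (size J)} (hom : IsHomomorphism I J φ) where
  open IsHomomorphism hom

  ProperColoring-∘ : ∀ {f} → ProperColoring J f → ProperColoring I (f ∘ φ)
  ProperColoring-∘ (edge≢ , arc<) =
    (λ u v e → edge≢ _ _ (preserves-Edge u v e)) , (λ u v a → arc< _ _ (preserves-Arc u v a))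

  Adjacent-map : ∀ {u v} → Adjacent I u v → Adjacent J (φ u) (φ v)
  Adjacent-map (inj₁ e)        = inj₁ (preserves-Edge _ _ e)
  Adjacent-map (inj₂ (inj₁ a)) = inj₂ (inj₁ (preserves-Arc _ _ a))
  Adjacent-map (inj₂ (inj₂ a)) = inj₂ (inj₂ (preserves-Arc _ _ a))

-- The family

card : ℕ → ℕ
card zero    = 1
card (suc m) = 2 + (card m + card m)

len : ℕ → ℕ
len zero    = 0
len (suc m) = 5 + (len m + len m)

data Part (m : ℕ) : Set where
  L R : Part m
  l r : Fin (card m) → Part m

toPart : ∀ m → Fin (card (suc m)) → Part m
toPart m Fin.zero                 = L
toPart m (Fin.suc Fin.zero)       = R
toPart m (Fin.suc (Fin.suc v))    = [ l , r ]′ (splitAt (card m) v)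

fromPart : ∀ m → Part m → Fin (card (suc m))
fromPart m L     = Fin.zero
fromPart m R     = Fin.suc Fin.zero
fromPart m (l a) = Fin.suc (Fin.suc (a ↑ˡ card m))
fromPart m (r b) = Fin.suc (Fin.suc (card m ↑ʳ b))

toPart-fromPart : ∀ m t → toPart m (fromPart m t) ≡ t
toPart-fromPart m L     = refl
toPart-fromPart m R     = refl
toPart-fromPart m (l a) rewrite splitAt-↑ˡ (card m) a (card m) = refl
toPart-fromPart m (r b) rewrite splitAt-↑ʳ (card m) (card m) b = refl

fromPart-toPart : ∀ m v → fromPart m (toPart m v) ≡ v
fromPart-toPart m Fin.zero              = refl
fromPart-toPart m (Fin.suc Fin.zero)    = refl
fromPart-toPart m (Fin.suc (Fin.suc v)) with splitAt (card m) v in eq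
... | inj₁ a = cong (Fin.suc ∘ Fin.suc) (splitAt⁻¹-↑ˡ eq)
... | inj₂ b = cong (Fin.suc ∘ Fin.suc) (splitAt⁻¹-↑ʳ eq)

toPart-injective : ∀ m {u v} → toPart m u ≡ toPart m v → u ≡ v
toPart-injective m {u} {v} eq =
  trans (sym (fromPart-toPart m u)) (trans (cong (fromPart m) eq) (fromPart-toPart m v))

fromPart-injective : ∀ m {t t′} → fromPart m t ≡ fromPart m t′ → t ≡ t′
fromPart-injective m {t} {t′} eq =
  trans (sym (toPart-fromPart m t)) (trans (cong (toPart m) eq) (toPart-fromPart m t′))

mutual
  intervals : ∀ m → Fin (card m) → Interval
  intervals zero    _ = [ 0 , 0 ]⟨ z≤n ⟩
  intervals (suc m) v = partInterval m (toPart m v)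

  partInterval : ∀ m → Part m → Interval
  partInterval m L     = [ 0 , 3 + len m ]⟨ z≤n ⟩
  partInterval m R     = [ 3 + len m , 5 + (len m + len m) ]⟨ ≤-trans (m≤m+n (3 + len m) (len m)) (m≤n+m _ 2) ⟩
  partInterval m (l a) = shift 1 (intervals m a)
  partInterval m (r b) = shift (4 + len m) (intervals m b)

mutual
  intervals-within : ∀ m v → Within 0 (len m) (intervals m v)
  intervals-within zero    _ = within z≤n z≤n
  intervals-within (suc m) v = partInterval-within m (toPart m v)

  partInterval-within : ∀ m t → Within 0 (len (suc m)) (partInterval m t)
  partInterval-within m L     = within z≤n (≤-trans (m≤m+n (3 + len m) (len m)) (m≤n+m _ 2))
  partInterval-within m R     = within z≤n ≤-refl
  partInterval-within m (l a) =
    Within-weaken z≤n (s≤s (≤-trans (m≤m+n _ (len m)) (m≤n+m _ 4))) (Within-shift 1 (intervals-within m a))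
  partInterval-within m (r b) =
    Within-weaken z≤n (n≤1+n _) (Within-shift (4 + len m) (intervals-within m b))

module Geometry (m : ℕ) where
  private
    K = len m
    P = partInterval m

  within-l : ∀ a → Within 1 (1 + K) (P (l a))
  within-l a = Within-shift 1 (intervals-within m a)

  within-r : ∀ b → Within (4 + K) (4 + K + K) (P (r b))
  within-r b = Within-weaken (m≤m+n (4 + K) 0) ≤-refl (Within-shift (4 + K) (intervals-within m b))

  L⊇l : ∀ a → Contains (P L) (P (l a))
  L⊇l a = Within⇒Contains {P L} (Within-weaken z≤n (s≤s (m≤n+m K 2)) (within-l a))

  l⊉L : ∀ a → ¬ Contains (P (l a)) (P L)
  l⊉L a = lo<lo⇒¬Contains {P (l a)} {P L} (s≤s z≤n)

  R⊇r : ∀ b → Contains (P R) (P (r b))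
  R⊇r b = Within⇒Contains {P R} (Within-weaken (n≤1+n _) (n≤1+n _) (within-r b))

  r⊉R : ∀ b → ¬ Contains (P (r b)) (P R)
  r⊉R b = lo<lo⇒¬Contains {P (r b)} {P R} (s≤s (m≤m+n (3 + K) (lo (intervals m b))))

  L⊉R : ¬ Contains (P L) (P R)
  L⊉R (_ , hiR≤hiL) = <⇒≱ (s≤s (≤-trans (m≤m+n (3 + K) K) (n≤1+n _))) hiR≤hiL

  R⊉L : ¬ Contains (P R) (P L)
  R⊉L = lo<lo⇒¬Contains {P R} {P L} (s≤s z≤n)

  L⋈R : Overlap (P L) (P R)
  L⋈R = (z≤n , ≤-refl) , L⊉R , R⊉L

  l-R-disjoint : ∀ a → ¬ Intersect (P (l a)) (P R)
  l-R-disjoint a = separated {v = P R} (within-l a) (within (≤-refl {3 + K}) ≤-refl) (n≤1+n (2 + K))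

  L-r-disjoint : ∀ b → ¬ Intersect (P L) (P (r b))
  L-r-disjoint b = separated {u = P L} (within z≤n (≤-refl {3 + K})) (within-r b) ≤-refl

  l-r-disjoint : ∀ a b → ¬ Intersect (P (l a)) (P (r b))
  l-r-disjoint a b = separated (within-l a) (within-r b) (s≤s (s≤s (m≤n+m K 2)))

  -- The pairs of parts whose intervals may intersect: the other six pairs are disjoint.
  data Meet : Part m → Part m → Set where
    L-L : Meet L L
    R-R : Meet R R
    L-R : Meet L R
    R-L : Meet R L
    L-l : ∀ {a} → Meet L (l a)
    l-L : ∀ {a} → Meet (l a) L
    R-r : ∀ {b} → Meet R (r b)
    r-R : ∀ {b} → Meet (r b) R
    l-l : ∀ {a a′} → Meet (l a) (l a′)
    r-r : ∀ {b b′} → Meet (r b) (r b′)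

  meet : ∀ t t′ → Intersect (P t) (P t′) → Meet t t′
  meet L     L      _ = L-L
  meet L     R      _ = L-R
  meet L     (l a)  _ = L-l
  meet L     (r b)  i = contradiction i (L-r-disjoint b)
  meet R     L      _ = R-L
  meet R     R      _ = R-R
  meet R     (l a)  i = contradiction (Intersect-sym {P R} {P (l a)} i) (l-R-disjoint a)
  meet R     (r b)  _ = R-r
  meet (l a) L      _ = l-L
  meet (l a) R      i = contradiction i (l-R-disjoint a)
  meet (l a) (l a′) _ = l-l
  meet (l a) (r b)  i = contradiction i (l-r-disjoint a b)
  meet (r b) L      i = contradiction (Intersect-sym {P (r b)} {P L} i) (L-r-disjoint b)
  meet (r b) R      _ = r-R
  meet (r b) (l a)  i = contradiction (Intersect-sym {P (r b)} {P (l a)} i) (l-r-disjoint a b)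
  meet (r b) (r b′) _ = r-r

open Geometry

mutual
  intervals-injective : ∀ m u v → SameInterval (intervals m u) (intervals m v) → u ≡ v
  intervals-injective zero    Fin.zero Fin.zero _ = refl
  intervals-injective (suc m) u v same =
    toPart-injective m (partInterval-injective m (toPart m u) (toPart m v) same)

  partInterval-injective : ∀ m t t′ → SameInterval (partInterval m t) (partInterval m t′) → t ≡ t′
  partInterval-injective m t t′ same
    with meet m t t′ (SameInterval⇒Intersect {P t} {P t′} same)
       | SameInterval⇒Contains {P t} {P t′} same
       | SameInterval⇒Contains {P t′} {P t} (SameInterval-sym {P t} {P t′} same)
    where P = partInterval m
  ... | L-L     | _     | _     = refl
  ... | R-R     | _     | _     = refl
  ... | L-R     | L⊇R   | _     = contradiction L⊇R (L⊉R m)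
  ... | R-L     | R⊇L   | _     = contradiction R⊇L (R⊉L m)
  ... | L-l {a} | _     | l⊇L   = contradiction l⊇L (l⊉L m a)
  ... | l-L {a} | l⊇L   | _     = contradiction l⊇L (l⊉L m a)
  ... | R-r {b} | _     | r⊇R   = contradiction r⊇R (r⊉R m b)
  ... | r-R {b} | r⊇R   | _     = contradiction r⊇R (r⊉R m b)
  ... | l-l {a} {a′} | _ | _ =
    cong l (intervals-injective m a a′ (suc-injective (proj₁ same) , suc-injective (proj₂ same)))
  ... | r-r {b} {b′} | _ | _ =
    cong r (intervals-injective m b b′ (+-cancelˡ-≡ k _ _ (proj₁ same) , +-cancelˡ-≡ k _ _ (proj₂ same)))
    where k = 4 + len m

ℐ : ℕ → IntervalSet
ℐ m = record { size = card m ; interval = intervals m ; distinct = intervals-injective m }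

fromPart-preserves : ∀ m (Rel : Interval → Interval → Set) {t t′} →
                     Rel (partInterval m t) (partInterval m t′) →
                     Rel (intervals (suc m) (fromPart m t)) (intervals (suc m) (fromPart m t′))
fromPart-preserves m Rel {t} {t′} =
  subst₂ (λ x y → Rel (partInterval m x) (partInterval m y)) (sym (toPart-fromPart m t)) (sym (toPart-fromPart m t′))

module _ (m k : ℕ) (part : Fin (card m) → Part m) (part-injective : ∀ {a a′} → part a ≡ part a′ → a ≡ a′)
         (part-shift : ∀ a → partInterval m (part a) ≡ shift k (intervals m a)) where

  private
    copy = fromPart m ∘ part

    copy-≢ : ∀ {a a′} → a ≢ a′ → copy a ≢ copy a′
    copy-≢ a≢a′ = a≢a′ ∘ part-injective ∘ fromPart-injective m

    copy-preserves : ∀ (Rel : Interval → Interval → Set) {a a′} →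
                     Rel (shift k (intervals m a)) (shift k (intervals m a′)) →
                     Rel (intervals (suc m) (copy a)) (intervals (suc m) (copy a′))
    copy-preserves Rel {a} {a′} =
      fromPart-preserves m Rel ∘ subst₂ Rel (sym (part-shift a)) (sym (part-shift a′))

  copy-isHomomorphism : IsHomomorphism (ℐ m) (ℐ (suc m)) copy
  copy-isHomomorphism = record
    { preserves-Edge = λ a a′ (a≢a′ , o) →
        copy-≢ a≢a′ , copy-preserves Overlap (shift-Overlap k {intervals m a} {intervals m a′} o)
    ; preserves-Arc = λ a a′ (a≢a′ , i , c) →
        copy-≢ a≢a′ , copy-preserves Intersect (shift-Intersect k {intervals m a} {intervals m a′} i)
                    , copy-preserves Contains (shift-Contains k {intervals m a} {intervals m a′} c)
    }

copyˡ-isHomomorphism : ∀ m → IsHomomorphism (ℐ m) (ℐ (suc m)) (fromPart m ∘ l)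
copyˡ-isHomomorphism m = copy-isHomomorphism m 1 l (λ { refl → refl }) (λ _ → refl)

copyʳ-isHomomorphism : ∀ m → IsHomomorphism (ℐ m) (ℐ (suc m)) (fromPart m ∘ r)
copyʳ-isHomomorphism m = copy-isHomomorphism m (4 + len m) r (λ { refl → refl }) (λ _ → refl)

fromPart-Arc : ∀ m {t t′} → fromPart m t ≢ fromPart m t′ →
               Contains (partInterval m t) (partInterval m t′) →
               Arc (ℐ (suc m)) (fromPart m t) (fromPart m t′)
fromPart-Arc m {t} {t′} t≢t′ t⊇t′ =
    t≢t′
  , fromPart-preserves m Intersect {t} {t′} (Contains⇒Intersect {partInterval m t} {partInterval m t′} t⊇t′)
  , fromPart-preserves m Contains {t} {t′} t⊇t′

L→l : ∀ m a → Arc (ℐ (suc m)) (fromPart m L) (fromPart m (l a))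
L→l m a = fromPart-Arc m {L} {l a} (λ ()) (L⊇l m a)

R→r : ∀ m b → Arc (ℐ (suc m)) (fromPart m R) (fromPart m (r b))
R→r m b = fromPart-Arc m {R} {r b} (λ ()) (R⊇r m b)

L-R-Edge : ∀ m → Edge (ℐ (suc m)) (fromPart m L) (fromPart m R)
L-R-Edge m = (λ ()) , fromPart-preserves m Overlap {L} {R} (L⋈R m)

mutual
  colour : ∀ m → Fin (card m) → ℕ
  colour zero    _ = 0
  colour (suc m) v = partColour m (toPart m v)

  partColour : ∀ m → Part m → ℕ
  partColour m L     = 1
  partColour m R     = 0
  partColour m (l a) = 2 + colour m a
  partColour m (r b) = 1 + colour m b

mutual
  colour≤ : ∀ m v → colour m v ≤ m + m
  colour≤ zero    _ = z≤n
  colour≤ (suc m) v = partColour≤ m (toPart m v)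

  partColour≤ : ∀ m t → partColour m t ≤ suc m + suc m
  partColour≤ m L     = s≤s z≤n
  partColour≤ m R     = z≤n
  partColour≤ m (l a) = ≤-trans (+-monoʳ-≤ 2 (colour≤ m a)) (≤-reflexive (cong suc (sym (+-suc m m))))
  partColour≤ m (r b) = s≤s (≤-trans (colour≤ m b) (+-monoʳ-≤ m (n≤1+n m)))

colour-proper : ∀ m → ProperColoring (ℐ m) (colour m)
colour-proper zero    = (λ { Fin.zero Fin.zero (0≢0 , _) → contradiction refl 0≢0 })
                      , (λ { Fin.zero Fin.zero (0≢0 , _) → contradiction refl 0≢0 })
colour-proper (suc m) =
    (λ u v (u≢v , o) → edge≢ (toPart m u) (toPart m v) (u≢v ∘ toPart-injective m) o)
  , (λ u v (u≢v , i , c) → arc< (toPart m u) (toPart m v) (u≢v ∘ toPart-injective m) i c)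
  where
  P = partInterval m
  I = intervals m
  proper = colour-proper m

  edge≢ : ∀ t t′ → t ≢ t′ → Overlap (P t) (P t′) → partColour m t ≢ partColour m t′
  edge≢ t t′ t≢t′ o@(i , t⊉t′ , t′⊉t) with meet m t t′ i
  ... | L-L = contradiction refl t≢t′
  ... | R-R = contradiction refl t≢t′
  ... | L-R = λ ()
  ... | R-L = λ ()
  ... | L-l {a} = contradiction (L⊇l m a) t⊉t′
  ... | l-L {a} = contradiction (L⊇l m a) t′⊉t
  ... | R-r {b} = contradiction (R⊇r m b) t⊉t′
  ... | r-R {b} = contradiction (R⊇r m b) t′⊉t
  ... | l-l {a} {a′} = proj₁ proper a a′ (t≢t′ ∘ cong l , shift-Overlap⁻¹ 1 {I a} {I a′} o)
                     ∘ suc-injective ∘ suc-injective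
  ... | r-r {b} {b′} = proj₁ proper b b′ (t≢t′ ∘ cong r , shift-Overlap⁻¹ (4 + len m) {I b} {I b′} o)
                     ∘ suc-injective

  arc< : ∀ t t′ → t ≢ t′ → Intersect (P t) (P t′) → Contains (P t) (P t′) → partColour m t < partColour m t′
  arc< t t′ t≢t′ i t⊇t′ with meet m t t′ i
  ... | L-L = contradiction refl t≢t′
  ... | R-R = contradiction refl t≢t′
  ... | L-R = contradiction t⊇t′ (L⊉R m)
  ... | R-L = contradiction t⊇t′ (R⊉L m)
  ... | L-l = s≤s (s≤s z≤n)
  ... | l-L {a} = contradiction t⊇t′ (l⊉L m a)
  ... | R-r = s≤s z≤n
  ... | r-R {b} = contradiction t⊇t′ (r⊉R m b)
  ... | l-l {a} {a′} = s≤s (s≤s (proj₂ proper a a′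
                         (t≢t′ ∘ cong l , shift-Intersect⁻¹ 1 {I a} {I a′} i , shift-Contains⁻¹ 1 {I a} {I a′} t⊇t′)))
  ... | r-r {b} {b′} = s≤s (proj₂ proper b b′
                         (t≢t′ ∘ cong r , shift-Intersect⁻¹ k {I b} {I b′} i , shift-Contains⁻¹ k {I b} {I b′} t⊇t′))
    where k = 4 + len m

mutual
  ProperColoring⇒spread : ∀ m f → ProperColoring (ℐ m) f → ∀ c → (∀ v → c ≤ f v) →
                          ∃[ v ] c + (m + m) ≤ f v
  ProperColoring⇒spread zero    f _ c c≤f = Fin.zero , ≤-trans (≤-reflexive (+-identityʳ c)) (c≤f Fin.zero)
  ProperColoring⇒spread (suc m) f proper@(edge≢ , arc<) c c≤f with f (fromPart m L) ≤? c
  ... | no  fL≰c = spread-from-copy m f proper c (copyˡ-isHomomorphism m)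
                     (λ a → ≤-trans (s≤s (≰⇒> fL≰c)) (arc< _ _ (L→l m a)))
  ... | yes fL≤c = spread-from-copy m f proper c (copyʳ-isHomomorphism m)
                     (λ b → ≤-trans (s≤s c<fR) (arc< _ _ (R→r m b)))
    where
    c<fR : c < f (fromPart m R)
    c<fR = ≤∧≢⇒< (c≤f _) λ c≡fR → edge≢ _ _ (L-R-Edge m) (trans (≤-antisym fL≤c (c≤f _)) c≡fR)

  spread-from-copy : ∀ m f → ProperColoring (ℐ (suc m)) f → ∀ c {copy} →
                     IsHomomorphism (ℐ m) (ℐ (suc m)) copy → (∀ a → 2 + c ≤ f (copy a)) →
                     ∃[ v ] c + (suc m + suc m) ≤ f v
  spread-from-copy m f proper c {copy} hom 2+c≤f
    with ProperColoring⇒spread m (f ∘ copy) (ProperColoring-∘ hom proper) (2 + c) 2+c≤f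
  ... | a , bound = copy a , ≤-trans (≤-reflexive (shuffle c m)) bound
    where
    open +-*-Solver
    shuffle : ∀ c m → c + (suc m + suc m) ≡ 2 + c + (m + m)
    shuffle = solve 2 (λ c m → c :+ ((con 1 :+ m) :+ (con 1 :+ m)) := con 2 :+ c :+ (m :+ m)) refl

chromaticNumber : ∀ m → ChromaticNumber (ℐ m) (suc (m + m))
chromaticNumber m = ChromaticNumber-intro (ℐ m) (m + m) (colour m) (colour-proper m) (colour≤ m)
                      (λ g proper → ProperColoring⇒spread m g proper 0 (λ _ → z≤n))

mutual
  layer : ∀ m → Fin (card m) → Fin (suc m)
  layer zero    _ = Fin.zero
  layer (suc m) v = partLayer m (toPart m v)

  partLayer : ∀ m → Part m → Fin (suc (suc m))
  partLayer m L     = fromℕ (suc m)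
  partLayer m R     = Fin.zero
  partLayer m (l a) = inject₁ (layer m a)
  partLayer m (r b) = Fin.suc (layer m b)

mutual
  layer-separates : ∀ m {u v} → u ≢ v → Intersect (intervals m u) (intervals m v) → layer m u ≢ layer m v
  layer-separates zero    {Fin.zero} {Fin.zero} 0≢0 _ = contradiction refl 0≢0
  layer-separates (suc m) {u} {v} u≢v i = partLayer-separates m (toPart m u) (toPart m v) (u≢v ∘ toPart-injective m) i

  partLayer-separates : ∀ m t t′ → t ≢ t′ → Intersect (partInterval m t) (partInterval m t′) →
                        partLayer m t ≢ partLayer m t′
  partLayer-separates m t t′ t≢t′ i with meet m t t′ i
  ... | L-L = contradiction refl t≢t′
  ... | R-R = contradiction refl t≢t′
  ... | L-R = λ ()
  ... | R-L = λ ()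
  ... | L-l = fromℕ≢inject₁
  ... | l-L = fromℕ≢inject₁ ∘ sym
  ... | R-r = λ ()
  ... | r-R = λ ()
  ... | l-l {a} {a′} = layer-separates m (t≢t′ ∘ cong l) (shift-Intersect⁻¹ 1 {intervals m a} {intervals m a′} i)
                     ∘ inject₁-injective
  ... | r-r {b} {b′} = layer-separates m (t≢t′ ∘ cong r) (shift-Intersect⁻¹ (4 + len m) {intervals m b} {intervals m b′} i)
                     ∘ Fin-suc-injective

HasClique⇒≤suc : ∀ m {j} → HasClique (ℐ m) j → j ≤ suc m
HasClique⇒≤suc m = HasClique⇒≤ (ℐ m) (layer m)
  (λ u∼v → layer-separates m (Adjacent⇒≢ (ℐ m) u∼v) (Adjacent⇒Intersect (ℐ m) u∼v))

clique : ∀ m → Σ (Fin (suc m) → Fin (card m)) (IsClique (ℐ m))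
clique zero    = (λ _ → Fin.zero) , λ { Fin.zero Fin.zero 0≢0 → contradiction refl 0≢0 }
clique (suc m) with clique m
... | c , c-clique = fromPart m L ∷ fromPart m ∘ l ∘ c
                   , IsClique-cons (ℐ (suc m)) _ _ (λ a → inj₂ (inj₁ (L→l m (c a))))
                       (λ a b a≢b → Adjacent-map (copyˡ-isHomomorphism m) (c-clique a b a≢b))

cliqueNumber : ∀ m → CliqueNumber (ℐ m) (suc m)
cliqueNumber m = IsClique⇒HasClique (ℐ m) (proj₁ (clique m)) (proj₂ (clique m)) , λ j → HasClique⇒≤suc m

card+2≡3*2^m : ∀ m → card m + 2 ≡ 3 * 2 ^ m
card+2≡3*2^m zero    = refl
card+2≡3*2^m (suc m) = begin
  2 + (card m + card m) + 2     ≡⟨ solve 1 (λ n → con 2 :+ (n :+ n) :+ con 2 := (n :+ con 2) :+ (n :+ con 2)) refl (card m) ⟩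
  (card m + 2) + (card m + 2)   ≡⟨ cong₂ _+_ (card+2≡3*2^m m) (card+2≡3*2^m m) ⟩
  3 * 2 ^ m + 3 * 2 ^ m         ≡⟨ solve 1 (λ p → con 3 :* p :+ con 3 :* p := con 3 :* (con 2 :* p)) refl (2 ^ m) ⟩
  3 * 2 ^ suc m                 ∎
  where
  open ≡-Reasoning
  open +-*-Solver

-- The left-hand side reduces to m + (suc m + 0).
2*[1+m]∸1≡1+m+m : ∀ m → 2 * suc m ∸ 1 ≡ suc (m + m)
2*[1+m]∸1≡1+m+m = solve 1 (λ m → m :+ ((con 1 :+ m) :+ con 0) := con 1 :+ (m :+ m)) refl
  where open +-*-Solver

proposition4 : Σ (ℕ → IntervalSet) λ I →
    ∀ n → 1 ≤ n →
      (size (I n) ≡ 3 * 2 ^ (n ∸ 1) ∸ 2)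
      × ChromaticNumber (I n) (2 * n ∸ 1)
      × CliqueNumber (I n) n
proposition4 = ℐ ∘ pred , λ where
  zero    ()
  (suc m) _ → trans (sym (m+n∸n≡m (card m) 2)) (cong (_∸ 2) (card+2≡3*2^m m))
            , subst (ChromaticNumber (ℐ m)) (sym (2*[1+m]∸1≡1+m+m m)) (chromaticNumber m)
            , cliqueNumber m
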